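{- Let $G$ be a graph, $t \in \mathbb{N}$, and $x,y \in V(G)$ distinct with $xy \notin E(G)$ such that there exist $t+3$ pairwise internally vertex-disjoint paths in $G$ between $x$ and $y$. Let $G'$ be obtained from $G$ by adding the edge $xy$. Then $\mathrm{TW2D}(G) \le t$ if and only if $\mathrm{TW2D}(G') \le t$.
   Context: Graphs are finite, simple, undirected; $\mathrm{tw}$ is treewidth. $\mathrm{TW2D}(G)$ is the minimum size of $S \subseteq V(G)$ with $\mathrm{tw}(G-S)\le 2$. -}

module Defs where

open import Data.Nat using (ℕ; suc; _≤_)
open import Data.Fin using (Fin)
open import Data.Fin.Subset using (Subset; _∈_; ∁; ∣_∣)
open import Data.List using (List; []; _∷_; _++_; head; last; length)
open import Data.List.Membership.Propositional renaming (_∈_ to _∈ₗ_)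
open import Data.List.Relation.Unary.All using (All)
open import Data.List.Relation.Unary.Unique.Propositional using (Unique)
open import Data.List.Relation.Unary.Linked using (Linked)
open import Data.Maybe using (Maybe; just)
open import Data.Product using (Σ; ∃; _×_; _,_)
open import Data.Sum using (_⊎_; inj₁; inj₂)
open import Data.Unit using (⊤)
open import Relation.Nullary using (¬_)
open import Relation.Binary.PropositionalEquality using (_≡_; _≢_; refl; sym)

record Graph (n : ℕ) : Set₁ where
  field
    Adj    : Fin n → Fin n → Set
    Adj-sym    : ∀ {u v} → Adj u v → Adj v u
    Adj-irrefl : ∀ {v} → ¬ Adj v v
open Graph public

WalkIn : ∀ {n} → Graph n → (Fin n → Set) → Fin n → Fin n → Set
WalkIn G P u v = Σ (List _) λ ws →
  head ws ≡ just u × last ws ≡ just v × Linked (Adj G) ws × All P ws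

Connected : ∀ {n} → Graph n → Set
Connected G = ∀ u v → WalkIn G (λ _ → ⊤) u v

HasCycle : ∀ {n} → Graph n → Set
HasCycle G = Σ (Fin _) λ v → Σ (List _) λ ws →
  Unique (v ∷ ws) × 2 ≤ length ws × Linked (Adj G) (v ∷ ws ++ (v ∷ []))

IsTree : ∀ {n} → Graph n → Set
IsTree G = Connected G × ¬ HasCycle G

-- A tree decomposition of width ≤ k of the induced subgraph G[U]
-- (bags are subsets of U, the decomposition tree is nonempty).
record TreeDecomp {n : ℕ} (G : Graph n) (U : Subset n) (k : ℕ) : Set₁ where
  field
    m     : ℕ
    T     : Graph (suc m)
    tree  : IsTree T
    bag   : Fin (suc m) → Subset n
    bag⊆U : ∀ i v → v ∈ bag i → v ∈ U
    vertex-cover : ∀ v → v ∈ U → ∃ λ i → v ∈ bag i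
    edge-cover   : ∀ u v → u ∈ U → v ∈ U → Adj G u v → ∃ λ i → u ∈ bag i × v ∈ bag i
    coherence    : ∀ v i j → v ∈ bag i → v ∈ bag j → WalkIn T (λ l → v ∈ bag l) i j
    width        : ∀ i → ∣ bag i ∣ ≤ suc k

TwInducedAtMost : ∀ {n} → Graph n → Subset n → ℕ → Set₁
TwInducedAtMost G U k = TreeDecomp G U k

TW2D≤ : ∀ {n} → Graph n → ℕ → Set₁
TW2D≤ {n} G t = Σ (Subset n) λ S → ∣ S ∣ ≤ t × TwInducedAtMost G (∁ S) 2

addEdgeAdj : ∀ {n} → Graph n → (x y : Fin n) → Fin n → Fin n → Set
addEdgeAdj G x y u v = Adj G u v ⊎ ((u ≡ x × v ≡ y) ⊎ (u ≡ y × v ≡ x))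

addEdge : ∀ {n} → Graph n → (x y : Fin n) → x ≢ y → Graph n
addEdge G x y x≢y = record
  { Adj = addEdgeAdj G x y
  ; Adj-sym = sy
  ; Adj-irrefl = ir
  }
  where
  sy : ∀ {u v} → addEdgeAdj G x y u v → addEdgeAdj G x y v u
  sy (inj₁ a) = inj₁ (Adj-sym G a)
  sy (inj₂ (inj₁ (p , q))) = inj₂ (inj₂ (q , p))
  sy (inj₂ (inj₂ (p , q))) = inj₂ (inj₁ (q , p))
  ir : ∀ {v} → ¬ addEdgeAdj G x y v v
  ir (inj₁ a) = Adj-irrefl G a
  ir (inj₂ (inj₁ (refl , q))) = x≢y q
  ir (inj₂ (inj₂ (refl , q))) = x≢y (sym q)

Path : ∀ {n} → Graph n → Fin n → Fin n → Set
Path G x y = Σ (List _) λ ps →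
  head ps ≡ just x × last ps ≡ just y × Linked (Adj G) ps × Unique ps

pathVerts : ∀ {n} {G : Graph n} {x y} → Path G x y → List (Fin n)
pathVerts (ps , _) = ps

InternallyDisjointPaths : ∀ {n} → Graph n → Fin n → Fin n → ℕ → Set
InternallyDisjointPaths {n} G x y k = Σ (Fin k → Path G x y) λ P →
  ∀ i j → i ≢ j → ∀ v → v ∈ₗ pathVerts {G = G} (P i) → v ∈ₗ pathVerts {G = G} (P j) →
  v ≡ x ⊎ v ≡ y

{-# OPTIONS --safe #-}
-- Suppose tw(G − S) ≤ 2 with |S| ≤ t, x, y ∉ S, and no bag of a width-2
-- decomposition of G − S contains both x and y. Walking in the decomposition
-- tree from a bag of x to a bag of y, we leave the bags of x along an edge cd
-- with x ∈ bag c ∖ bag d. In a tree every edge is a bridge, so the adhesion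
-- bag c ∩ bag d separates x from y in G − S; it has at most 2 vertices, as x
-- is among the ≤ 3 vertices of bag c but not in it. Hence S ∪ (bag c ∩ bag d)
-- is an x–y separator of size ≤ t + 2, which t + 3 internally disjoint paths
-- rule out. So some bag contains x and y, and it also covers the new edge xy.
-- Conversely, a decomposition of G + xy is also one of its subgraph G.
module Submission where

open import Defs
open import Data.Nat using (ℕ; suc; _+_; z≤n; s≤s; s≤s⁻¹) renaming (_≤_ to _≤ℕ_; _<_ to _<ℕ_)
open import Data.Nat.Properties using (≤-trans; ≤-reflexive; n≤1+n; n<1+n; +-suc; +-monoʳ-≤; +-mono-≤-<; <-≤-trans; <⇒≱)
open import Data.Fin using (Fin; zero; suc; _≟_)
open import Data.Fin.Properties using (any?; suc-injective; injective⇒≤)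
open import Data.Fin.Subset using (Subset; inside; outside; _∈_; _∉_; ∁; ∣_∣; _∪_; _∩_)
open import Data.Fin.Subset.Properties
  using (_∈?_; x∈p∪q⁺; x∈p∪q⁻; x∈p∩q⁺; x∈p∩q⁻; x∈∁p⇒x∉p; x∉p⇒x∈∁p; p∩q⊆p; p⊂q⇒∣p∣<∣q∣)
open import Data.Vec.Base using ([]; _∷_; here; there)
open import Data.List using (List; []; _∷_; _++_; head; last)
open import Data.List.Relation.Unary.All using (All; []; _∷_)
open import Data.List.Relation.Unary.All.Properties using (¬Any⇒All¬)
open import Data.List.Relation.Unary.Any as Any using ()
open import Data.List.Relation.Unary.Linked using (Linked; [-]; _∷_)
open import Data.List.Relation.Unary.Unique.Propositional using (Unique)
open import Data.List.Relation.Unary.AllPairs using ([]; _∷_)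
open import Data.List.Membership.Propositional using (find) renaming (_∈_ to _∈ₗ_)
open import Data.Maybe using (just)
open import Data.Product using (Σ; ∃; ∃₂; _×_; _,_; proj₁; proj₂)
open import Data.Sum using (_⊎_; inj₁; inj₂; [_,_])
open import Data.Empty using (⊥-elim)
open import Function.Base using (_∘_)
open import Function.Bundles using (_⇔_; mk⇔)
open import Function.Definitions using (Injective)
open import Level using (0ℓ)
open import Relation.Nullary using (¬_; yes; no)
open import Relation.Nullary.Decidable using (_×-dec_)
open import Relation.Unary using (Decidable)
open import Relation.Binary.Core using (Rel; _⇒_)
open import Relation.Binary.Definitions using (DecidableEquality)
open import Relation.Binary.PropositionalEquality using (_≡_; _≢_; refl; sym; cong; subst)
open import Relation.Binary.Construct.Closure.ReflexiveTransitive using (Star; ε; _◅_; _◅◅_; reverse)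
import Relation.Binary.Construct.Closure.ReflexiveTransitive as Star

Restrict : ∀ {A : Set} → Rel A 0ℓ → (A → Set) → Rel A 0ℓ
Restrict R P u v = R u v × P u × P v

Restrict-mono : ∀ {A : Set} {R : Rel A 0ℓ} {P Q : A → Set} →
  (∀ {v} → P v → Q v) → Restrict R P ⇒ Restrict R Q
Restrict-mono f (r , pu , pv) = r , f pu , f pv

module _ {A : Set} {R : Rel A 0ℓ} where

  linked⇒star : ∀ {P : A → Set} {u v} ws → head ws ≡ just u → last ws ≡ just v →
    Linked R ws → All P ws → Star (Restrict R P) u v
  linked⇒star (a ∷ []) refl refl _ _ = ε
  linked⇒star (a ∷ b ∷ ws) refl ws-last (r ∷ rs) (pa ∷ ps@(pb ∷ _)) =
    (r , pa , pb) ◅ linked⇒star (b ∷ ws) refl ws-last rs ps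

  vertsTail : ∀ {a b} → Star R a b → List A
  vertsTail ε = []
  vertsTail (_◅_ {j = b} r w) = b ∷ vertsTail w

  verts : ∀ {a b} → Star R a b → List A
  verts {a} w = a ∷ vertsTail w

  star⇒linked∷ʳ : ∀ {S : Rel A 0ℓ} → R ⇒ S → ∀ {a b c} (w : Star R a b) → S b c →
    Linked S (verts w ++ c ∷ [])
  star⇒linked∷ʳ f ε s = s ∷ [-]
  star⇒linked∷ʳ f (r ◅ w) s = f r ∷ star⇒linked∷ʳ f w s

  suffix : ∀ {a b v} (w : Star R a b) → v ∈ₗ verts w → Star R v b
  suffix w (Any.here refl) = w
  suffix (r ◅ w) (Any.there v∈w) = suffix w v∈w

  suffix-unique : ∀ {a b v} (w : Star R a b) (v∈w : v ∈ₗ verts w) →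
    Unique (verts w) → Unique (verts (suffix w v∈w))
  suffix-unique w (Any.here refl) u = u
  suffix-unique (r ◅ w) (Any.there v∈w) (_ ∷ u) = suffix-unique w v∈w u

  shortcut : DecidableEquality A → ∀ {a b} → Star R a b → Σ (Star R a b) (Unique ∘ verts)
  shortcut _≟ₐ_ ε = ε , [] ∷ []
  shortcut _≟ₐ_ (_◅_ {i = a} r w) with shortcut _≟ₐ_ w
  ... | p , p-unique with Any.any? (a ≟ₐ_) (verts p)
  ...   | yes a∈p = suffix p a∈p , suffix-unique p a∈p p-unique
  ...   | no a∉p = r ◅ p , ¬Any⇒All¬ _ a∉p ∷ p-unique

  exit-edge : ∀ {P : A → Set} → Decidable P → ∀ {i j} → Star R i j → P i → ¬ P j →
    ∃₂ λ c d → R c d × P c × ¬ P d × Star (Restrict R (¬_ ∘ P)) d j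
  exit-edge {P} P? w pi ¬pj with last-exit w
    where
    last-exit : ∀ {i} → Star R i _ →
      (¬ P i × Star (Restrict R (¬_ ∘ P)) i _) ⊎ (∃₂ λ c d → R c d × P c × ¬ P d × Star (Restrict R (¬_ ∘ P)) d _)
    last-exit ε = inj₁ (¬pj , ε)
    last-exit (_◅_ {i = a} r w) with last-exit w
    ... | inj₂ exit = inj₂ exit
    ... | inj₁ (¬pb , w-out) with P? a
    ...   | yes pa = inj₂ (_ , _ , r , pa , ¬pb , w-out)
    ...   | no ¬pa = inj₁ (¬pa , (r , ¬pa , ¬pb) ◅ w-out)
  ... | inj₁ (¬pi , _) = ⊥-elim (¬pi pi)
  ... | inj₂ exit = exit

walkIn⇒star : ∀ {n} {G : Graph n} {P : Fin n → Set} {u v} → WalkIn G P u v →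
  Star (Restrict (Adj G) P) u v
walkIn⇒star (ws , ws-head , ws-last , ws-linked , ws-P) = linked⇒star ws ws-head ws-last ws-linked ws-P

AdjExcept : ∀ {n} → Graph n → Fin n → Fin n → Rel (Fin n) 0ℓ
AdjExcept T c d u v = Adj T u v × ¬ (u ≡ c × v ≡ d) × ¬ (u ≡ d × v ≡ c)

AdjExcept-sym : ∀ {n} {T : Graph n} {c d u v} → AdjExcept T c d u v → AdjExcept T c d v u
AdjExcept-sym {T = T} (a , ¬cd , ¬dc) =
  Adj-sym T a , (λ { (refl , refl) → ¬dc (refl , refl) }) , (λ { (refl , refl) → ¬cd (refl , refl) })

Restrict⇒AdjExcept : ∀ {n} {T : Graph n} {c d} (Q : Fin n → Set) → ¬ (Q c × Q d) →
  Restrict (Adj T) Q ⇒ AdjExcept T c d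
Restrict⇒AdjExcept Q ¬cd (a , qu , qv) =
  a , (λ { (refl , refl) → ¬cd (qu , qv) }) , (λ { (refl , refl) → ¬cd (qv , qu) })

acyclic⇒bridge : ∀ {n} {T : Graph n} {c d} → ¬ HasCycle T → Adj T c d → ¬ Star (AdjExcept T c d) c d
acyclic⇒bridge {T = T} {c} acyclic cd w with shortcut _≟_ w
... | ε , _ = Adj-irrefl T cd
... | (r ◅ ε) , _ = proj₁ (proj₂ r) (refl , refl)
... | p@(_ ◅ _ ◅ _) , p-unique =
  acyclic (c , vertsTail p , p-unique , s≤s (s≤s z≤n) , star⇒linked∷ʳ proj₁ p (Adj-sym T cd))

index : ∀ {n} (W : Subset n) {v} → v ∈ W → Fin ∣ W ∣
index (inside ∷ W) here = zero
index (inside ∷ W) (there v∈W) = suc (index W v∈W)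
index (outside ∷ W) (there v∈W) = index W v∈W

index-injective : ∀ {n} (W : Subset n) {u v} (u∈W : u ∈ W) (v∈W : v ∈ W) →
  index W u∈W ≡ index W v∈W → u ≡ v
index-injective (inside ∷ W) here here _ = refl
index-injective (inside ∷ W) (there u∈W) (there v∈W) e = cong suc (index-injective W u∈W v∈W (suc-injective e))
index-injective (outside ∷ W) (there u∈W) (there v∈W) e = cong suc (index-injective W u∈W v∈W e)
index-injective (inside ∷ W) here (there _) ()
index-injective (inside ∷ W) (there _) here ()

injective⇒≤∣_∣ : ∀ {k n} {f : Fin k → Fin n} (W : Subset n) → (∀ i → f i ∈ W) →
  Injective _≡_ _≡_ f → k ≤ℕ ∣ W ∣
injective⇒≤∣ W ∣ f∈W f-injective = injective⇒≤ (f-injective ∘ index-injective W (f∈W _) (f∈W _))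

∣p∪q∣≤∣p∣+∣q∣ : ∀ {n} (p q : Subset n) → ∣ p ∪ q ∣ ≤ℕ ∣ p ∣ + ∣ q ∣
∣p∪q∣≤∣p∣+∣q∣ [] [] = z≤n
∣p∪q∣≤∣p∣+∣q∣ (inside ∷ p) (inside ∷ q) = s≤s (≤-trans (∣p∪q∣≤∣p∣+∣q∣ p q) (+-monoʳ-≤ ∣ p ∣ (n≤1+n ∣ q ∣)))
∣p∪q∣≤∣p∣+∣q∣ (inside ∷ p) (outside ∷ q) = s≤s (∣p∪q∣≤∣p∣+∣q∣ p q)
∣p∪q∣≤∣p∣+∣q∣ (outside ∷ p) (inside ∷ q) = ≤-trans (s≤s (∣p∪q∣≤∣p∣+∣q∣ p q)) (≤-reflexive (sym (+-suc ∣ p ∣ ∣ q ∣)))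
∣p∪q∣≤∣p∣+∣q∣ (outside ∷ p) (outside ∷ q) = ∣p∪q∣≤∣p∣+∣q∣ p q

Separates : ∀ {n} → Graph n → Subset n → Fin n → Fin n → Set
Separates G W x y = ¬ Star (Restrict (Adj G) (_∉ W)) x y

path-meets : ∀ {n} {G : Graph n} {W : Subset n} {x y} → Separates G W x y →
  (P : Path G x y) → ∃ λ v → v ∈ₗ pathVerts {G = G} P × v ∈ W
path-meets {W = W} separated (ps , ps-head , ps-last , ps-linked , _) with Any.any? (_∈? W) ps
... | yes meets = find meets
... | no misses = ⊥-elim (separated (linked⇒star ps ps-head ps-last ps-linked (¬Any⇒All¬ ps misses)))

disjoint-paths≤separator : ∀ {n} {G : Graph n} {W : Subset n} {x y k} → x ∉ W → y ∉ W →
  Separates G W x y → InternallyDisjointPaths G x y k → k ≤ℕ ∣ W ∣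
disjoint-paths≤separator {n} {G} {W} {x} {y} {k} x∉W y∉W separated (P , disjoint) =
  injective⇒≤∣_∣ {f = hit} W (proj₂ ∘ proj₂ ∘ meet) hit-injective
  where
  meet : ∀ i → ∃ λ v → v ∈ₗ pathVerts {G = G} (P i) × v ∈ W
  meet i = path-meets {G = G} {W} separated (P i)

  hit : Fin k → Fin n
  hit i = proj₁ (meet i)

  hit-injective : Injective _≡_ _≡_ hit
  hit-injective {i} {j} e with i ≟ j
  ... | yes i≡j = i≡j
  ... | no i≢j with disjoint i j i≢j (hit i) (proj₁ (proj₂ (meet i)))
                                      (subst (_∈ₗ pathVerts {G = G} (P j)) (sym e) (proj₁ (proj₂ (meet j))))
  ...   | inj₁ hit≡x = ⊥-elim (x∉W (subst (_∈ W) hit≡x (proj₂ (proj₂ (meet i)))))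
  ...   | inj₂ hit≡y = ⊥-elim (y∉W (subst (_∈ W) hit≡y (proj₂ (proj₂ (meet i)))))

module _ {n} {G : Graph n} {U : Subset n} {k : ℕ} (D : TreeDecomp G U k) where
  open TreeDecomp D

  Outside : Fin (suc m) → Fin (suc m) → Fin n → Set
  Outside c d v = v ∈ U × v ∉ bag c ∩ bag d

  bag-walk : ∀ {v c d i j} → v ∉ bag c ∩ bag d → v ∈ bag i → v ∈ bag j → Star (AdjExcept T c d) i j
  bag-walk {v} v∉cd vi vj =
    Star.map (Restrict⇒AdjExcept {T = T} (λ l → v ∈ bag l) (v∉cd ∘ x∈p∩q⁺)) (walkIn⇒star {G = T} (coherence v _ _ vi vj))

  graph-walk⇒tree-walk : ∀ {c d p q i j} → p ∉ bag c ∩ bag d →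
    Star (Restrict (Adj G) (Outside c d)) p q → p ∈ bag i → q ∈ bag j → Star (AdjExcept T c d) i j
  graph-walk⇒tree-walk p∉cd ε pi pj = bag-walk p∉cd pi pj
  graph-walk⇒tree-walk p∉cd ((pq , (pU , _) , (qU , q∉cd)) ◅ w) pi rj with edge-cover _ _ pU qU pq
  ... | l , pl , ql = bag-walk p∉cd pi pl ◅◅ graph-walk⇒tree-walk q∉cd w ql rj

  adhesion-separates : ∀ {c d j x y} → Adj T c d → Star (AdjExcept T c d) d j →
    x ∈ bag c → x ∉ bag d → y ∈ bag j → ¬ Star (Restrict (Adj G) (Outside c d)) x y
  adhesion-separates cd dj xc x∉d yj w = acyclic⇒bridge {T = T} (proj₂ tree) cd
    (graph-walk⇒tree-walk (x∉d ∘ proj₂ ∘ x∈p∩q⁻ _ _) w xc yj ◅◅ reverse (AdjExcept-sym {T = T}) dj)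

  adhesion-size : ∀ {c d x} → x ∈ bag c → x ∉ bag d → ∣ bag c ∩ bag d ∣ ≤ℕ k
  adhesion-size {c} {d} xc x∉d =
    s≤s⁻¹ (<-≤-trans (p⊂q⇒∣p∣<∣q∣ (p∩q⊆p (bag c) (bag d) , _ , xc , x∉d ∘ proj₂ ∘ x∈p∩q⁻ _ _)) (width c))

module _ {n} {G : Graph n} {S : Subset n} {k : ℕ} (D : TreeDecomp G (∁ S) k) where
  open TreeDecomp D

  apart⇒small-separator : ∀ {x y} → x ∈ ∁ S → y ∈ ∁ S → ¬ (∃ λ i → x ∈ bag i × y ∈ bag i) →
    ∃ λ W → x ∉ W × y ∉ W × Separates G W x y × ∣ W ∣ ≤ℕ ∣ S ∣ + k
  apart⇒small-separator {x} {y} xU yU apart with vertex-cover x xU | vertex-cover y yU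
  ... | i , xi | j , yj
    with exit-edge (λ l → x ∈? bag l) (Star.map proj₁ (walkIn⇒star {G = T} (proj₁ tree i j))) xi
                   (λ xj → apart (j , xj , yj))
  ... | c , d , cd , xc , x∉d , dj = S ∪ (bag c ∩ bag d) , x∉W , y∉W , separated , W-size
    where
    x∉W : x ∉ S ∪ (bag c ∩ bag d)
    x∉W = [ x∈∁p⇒x∉p xU , x∉d ∘ proj₂ ∘ x∈p∩q⁻ _ _ ] ∘ x∈p∪q⁻ S _

    y∉W : y ∉ S ∪ (bag c ∩ bag d)
    y∉W = [ x∈∁p⇒x∉p yU , (λ yc → apart (c , xc , yc)) ∘ proj₁ ∘ x∈p∩q⁻ _ _ ] ∘ x∈p∪q⁻ S _

    outside-W : ∀ {v} → v ∉ S ∪ (bag c ∩ bag d) → Outside D c d v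
    outside-W v∉W = x∉p⇒x∈∁p (v∉W ∘ x∈p∪q⁺ ∘ inj₁) , v∉W ∘ x∈p∪q⁺ ∘ inj₂

    separated : Separates G (S ∪ (bag c ∩ bag d)) x y
    separated w = adhesion-separates D cd
      (Star.map (Restrict⇒AdjExcept {T = T} (λ l → x ∉ bag l) (λ (x∉c , _) → x∉c xc)) dj)
      xc x∉d yj (Star.map (Restrict-mono {R = Adj G} outside-W) w)

    W-size : ∣ S ∪ (bag c ∩ bag d) ∣ ≤ℕ ∣ S ∣ + k
    W-size = ≤-trans (∣p∪q∣≤∣p∣+∣q∣ S _) (+-monoʳ-≤ ∣ S ∣ (adhesion-size D xc x∉d))

  shared-bag : ∀ {x y p} → ∣ S ∣ + k <ℕ p → InternallyDisjointPaths G x y p → x ∈ ∁ S → y ∈ ∁ S →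
    ∃ λ i → x ∈ bag i × y ∈ bag i
  shared-bag {x} {y} bound paths xU yU with any? (λ i → (x ∈? bag i) ×-dec (y ∈? bag i))
  ... | yes shared = shared
  ... | no apart with apart⇒small-separator xU yU apart
  ...   | W , x∉W , y∉W , separated , W-size =
    ⊥-elim (<⇒≱ bound (≤-trans (disjoint-paths≤separator {G = G} {W} x∉W y∉W separated paths) W-size))

TreeDecomp-mono : ∀ {n} {G H : Graph n} {U k} → (∀ {u v} → Adj G u v → Adj H u v) →
  TreeDecomp H U k → TreeDecomp G U k
TreeDecomp-mono G⊆H D = record
  { T = T ; tree = tree ; bag = bag ; bag⊆U = bag⊆U ; vertex-cover = vertex-cover
  ; edge-cover = λ u v uU vU uv → edge-cover u v uU vU (G⊆H uv)
  ; coherence = coherence ; width = width }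
  where open TreeDecomp D

TreeDecomp-addEdge : ∀ {n} {G : Graph n} {U k x y} (x≢y : x ≢ y) (D : TreeDecomp G U k) →
  (x ∈ U → y ∈ U → ∃ λ i → x ∈ TreeDecomp.bag D i × y ∈ TreeDecomp.bag D i) →
  TreeDecomp (addEdge G x y x≢y) U k
TreeDecomp-addEdge {G = G} {U} {x = x} {y} x≢y D shared = record
  { T = T ; tree = tree ; bag = bag ; bag⊆U = bag⊆U ; vertex-cover = vertex-cover
  ; edge-cover = edge-cover′ ; coherence = coherence ; width = width }
  where
  open TreeDecomp D
  edge-cover′ : ∀ u v → u ∈ U → v ∈ U → addEdgeAdj G x y u v → ∃ λ i → u ∈ bag i × v ∈ bag i
  edge-cover′ u v uU vU (inj₁ uv) = edge-cover u v uU vU uv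
  edge-cover′ u v uU vU (inj₂ (inj₁ (refl , refl))) = shared uU vU
  edge-cover′ u v uU vU (inj₂ (inj₂ (refl , refl))) with shared vU uU
  ... | i , vi , ui = i , ui , vi

lemma5p6 : ∀ {n} (G : Graph n) (t : ℕ) (x y : Fin n) (x≢y : x ≢ y) →
    ¬ Adj G x y → InternallyDisjointPaths G x y (t + 3) →
    (TW2D≤ G t ⇔ TW2D≤ (addEdge G x y x≢y) t)
lemma5p6 G t x y x≢y _ paths = mk⇔ to from
  where
  to : TW2D≤ G t → TW2D≤ (addEdge G x y x≢y) t
  to (S , S≤t , D) = S , S≤t , TreeDecomp-addEdge x≢y D (shared-bag D (+-mono-≤-< S≤t (n<1+n 2)) paths)

  from : TW2D≤ (addEdge G x y x≢y) t → TW2D≤ G t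
  from (S , S≤t , D) = S , S≤t , TreeDecomp-mono inj₁ D
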